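{- (1) Let $\underline{D}=(D;\sqcap,\sqcup,\neg,\lrcorner,\bot,\top)$ be a pure and trivial double Boolean algebra. Then the ordered set $(D;\sqsubseteq)$ is the glued sum $(D_{\sqcap};\sqsubseteq)\overset{\bullet}{+}(D_{\sqcup};\sqsubseteq)$; in particular the greatest element of $D_\sqcap$ is identified with the least element of $D_\sqcup$. (2) Conversely, let $\underline{P}=(P;\wedge_P,\vee_P,{}^{\prime_P},0_P,1_P)$ and $\underline{Q}=(Q;\wedge_Q,\vee_Q,{}^{\prime_Q},0_Q,1_Q)$ be Boolean algebras and let $D=P\overset{\bullet}{+}Q$ (so $D=P\cup Q$ with $P\cap Q=\{1_P\}=\{0_Q\}$). Put $\bot=0_P$, $\top=1_Q$ and for $x,y\in D$ define $x\sqcap y=x\wedge_P y$ if $x,y\in P$; $x\sqcap y=1_P$ if $x,y\in Q$; $x\sqcap y=x$ if $x\in P,y\in Q$; $x\sqcap y=y$ if $x\in Q,y\in P$; $x\sqcup y=x\vee_Q y$ if $x,y\in Q$; $x\sqcup y=0_Q$ if $x,y\in P$; $x\sqcup y=y$ if $x\in P,y\in Q$; $x\sqcup y=x$ if $x\in Q,y\in P$; $\neg x=x^{\prime_P}$ if $x\in P$ and $\neg x=0_P$ otherwise; $\lrcorner x=x^{\prime_Q}$ if $x\in Q$ and $\lrcorner x=1_Q$ otherwise. Then $(D;\sqcap,\sqcup,\neg,\lrcorner,\bot,\top)$ is a pure and trivial double Boolean algebra.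
   Context: A double Boolean algebra (dBa) is an algebra $\underline{D}=(D;\sqcap,\sqcup,\neg,\lrcorner,\bot,\top)$ of type $(2,2,1,1,0,0)$ satisfying, for all $x,y,z$, where $x\vee y:=\neg(\neg x\sqcap\neg y)$ and $x\wedge y:=\lrcorner(\lrcorner x\sqcup\lrcorner y)$: $(x\sqcap x)\sqcap y=x\sqcap y$; $(x\sqcup x)\sqcup y=x\sqcup y$; $\sqcap$ and $\sqcup$ are commutative and associative; $x\sqcap(x\sqcup y)=x\sqcap x$; $x\sqcup(x\sqcap y)=x\sqcup x$; $x\sqcap(x\vee y)=x\sqcap x$; $x\sqcup(x\wedge y)=x\sqcup x$; $x\sqcap(y\vee z)=(x\sqcap y)\vee(x\sqcap z)$; $x\sqcup(y\wedge z)=(x\sqcup y)\wedge(x\sqcup z)$; $\neg\neg(x\sqcap y)=x\sqcap y$; $\lrcorner\lrcorner(x\sqcup y)=x\sqcup y$; $\neg(x\sqcap x)=\neg x$; $\lrcorner(x\sqcup x)=\lrcorner x$; $x\sqcap\neg x=\bot$; $x\sqcup\lrcorner x=\top$; $\neg\bot=\top\sqcap\top$; $\lrcorner\top=\bot\sqcup\bot$; $\neg\top=\bot$; $\lrcorner\bot=\top$; $(x\sqcap x)\sqcup(x\sqcap x)=(x\sqcup x)\sqcap(x\sqcup x)$. Let $D_\sqcap=\{x\in D: x\sqcap x=x\}$, $D_\sqcup=\{x\in D: x\sqcup x=x\}$. $\underline{D}$ is pure if $D=D_\sqcap\cup D_\sqcup$, and trivial if $\top\sqcap\top=\bot\sqcup\bot$.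 The quasi-order $\sqsubseteq$ on $D$ is: $x\sqsubseteq y$ iff $x\sqcap y=x\sqcap x$ and $x\sqcup y=y\sqcup y$. It is known that $(D_\sqcap;\sqcap,\vee,\neg,\bot,\neg\bot)$ and $(D_\sqcup;\wedge,\sqcup,\lrcorner,\lrcorner\top,\top)$ are Boolean algebras whose orders are the restrictions of $\sqsubseteq$. For posets $P$ with a greatest element $1_P$ and $Q$ with a least element $0_Q$, the glued sum $P\overset{\bullet}{+}Q$ is the ordinal sum $P+Q$ (on $P\cup Q$, with $x\le y$ if $x,y\in P$ and $x\le_P y$, or $x,y\in Q$ and $x\le_Q y$, or $x\in P,y\in Q$) in which $1_P$ and $0_Q$ are identified. -}

module Defs where

open import Level using (Level; suc; Lift) renaming (_⊔_ to _⊔ˡ_)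
open import Data.Sum using (_⊎_; inj₁; inj₂)
open import Data.Product using (_×_)
open import Function.Bundles using (_⇔_)
open import Relation.Binary.Core using (Rel)
open import Relation.Binary.Structures using (IsEquivalence)
open import Algebra.Core using (Op₁; Op₂)
open import Algebra.Lattice.Bundles using (BooleanAlgebra)

module _ {a ℓ : Level} {D : Set a} (_≈_ : Rel D ℓ)
         (_⊓_ _⊔_ : Op₂ D) (¬_ ⌐_ : Op₁ D) where

  private
    _∨_ : Op₂ D
    x ∨ y = ¬ ((¬ x) ⊓ (¬ y))
    _∧_ : Op₂ D
    x ∧ y = ⌐ ((⌐ x) ⊔ (⌐ y))

  record IsDBA (⊥ ⊤ : D) : Set (a ⊔ˡ ℓ) where
    field
      isEquivalence : IsEquivalence _≈_
      ⊓-cong : ∀ {x x′ y y′} → x ≈ x′ → y ≈ y′ → (x ⊓ y) ≈ (x′ ⊓ y′)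
      ⊔-cong : ∀ {x x′ y y′} → x ≈ x′ → y ≈ y′ → (x ⊔ y) ≈ (x′ ⊔ y′)
      ¬-cong : ∀ {x x′} → x ≈ x′ → (¬ x) ≈ (¬ x′)
      ⌐-cong : ∀ {x x′} → x ≈ x′ → (⌐ x) ≈ (⌐ x′)
      ax1a : ∀ x y → ((x ⊓ x) ⊓ y) ≈ (x ⊓ y)
      ax1b : ∀ x y → ((x ⊔ x) ⊔ y) ≈ (x ⊔ y)
      ax2a : ∀ x y → (x ⊓ y) ≈ (y ⊓ x)
      ax2b : ∀ x y → (x ⊔ y) ≈ (y ⊔ x)
      ax3a : ∀ x y z → (x ⊓ (y ⊓ z)) ≈ ((x ⊓ y) ⊓ z)
      ax3b : ∀ x y z → (x ⊔ (y ⊔ z)) ≈ ((x ⊔ y) ⊔ z)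
      ax4a : ∀ x y → (x ⊓ (x ⊔ y)) ≈ (x ⊓ x)
      ax4b : ∀ x y → (x ⊔ (x ⊓ y)) ≈ (x ⊔ x)
      ax5a : ∀ x y → (x ⊓ (x ∨ y)) ≈ (x ⊓ x)
      ax5b : ∀ x y → (x ⊔ (x ∧ y)) ≈ (x ⊔ x)
      ax6a : ∀ x y z → (x ⊓ (y ∨ z)) ≈ ((x ⊓ y) ∨ (x ⊓ z))
      ax6b : ∀ x y z → (x ⊔ (y ∧ z)) ≈ ((x ⊔ y) ∧ (x ⊔ z))
      ax7a : ∀ x y → (¬ (¬ (x ⊓ y))) ≈ (x ⊓ y)
      ax7b : ∀ x y → (⌐ (⌐ (x ⊔ y))) ≈ (x ⊔ y)
      ax8a : ∀ x → (¬ (x ⊓ x)) ≈ (¬ x)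
      ax8b : ∀ x → (⌐ (x ⊔ x)) ≈ (⌐ x)
      ax9a : ∀ x → (x ⊓ (¬ x)) ≈ ⊥
      ax9b : ∀ x → (x ⊔ (⌐ x)) ≈ ⊤
      ax10a : (¬ ⊥) ≈ (⊤ ⊓ ⊤)
      ax10b : (⌐ ⊤) ≈ (⊥ ⊔ ⊥)
      ax11a : (¬ ⊤) ≈ ⊥
      ax11b : (⌐ ⊥) ≈ ⊤
      ax12 : ∀ x → ((x ⊓ x) ⊔ (x ⊓ x)) ≈ ((x ⊔ x) ⊓ (x ⊔ x))

IsPure : ∀ {a ℓ} {D : Set a} → Rel D ℓ → Op₂ D → Op₂ D → Set (a ⊔ˡ ℓ)
IsPure _≈_ _⊓_ _⊔_ = ∀ x → ((x ⊓ x) ≈ x) ⊎ ((x ⊔ x) ≈ x)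

IsTrivial : ∀ {a ℓ} {D : Set a} → Rel D ℓ → Op₂ D → Op₂ D → D → D → Set ℓ
IsTrivial _≈_ _⊓_ _⊔_ ⊥ ⊤ = (⊤ ⊓ ⊤) ≈ (⊥ ⊔ ⊥)

record DBA (a ℓ : Level) : Set (suc (a ⊔ˡ ℓ)) where
  field
    Carrier : Set a
    _≈_ : Rel Carrier ℓ
    _⊓_ _⊔_ : Op₂ Carrier
    ¬_ ⌐_ : Op₁ Carrier
    ⊥ ⊤ : Carrier
    isDBA : IsDBA _≈_ _⊓_ _⊔_ ¬_ ⌐_ ⊥ ⊤

  D⊓ : Carrier → Set ℓ
  D⊓ x = (x ⊓ x) ≈ x
  D⊔ : Carrier → Set ℓ
  D⊔ x = (x ⊔ x) ≈ x

  _⊑_ : Rel Carrier ℓ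
  x ⊑ y = ((x ⊓ y) ≈ (x ⊓ x)) × ((x ⊔ y) ≈ (y ⊔ y))

  Pure : Set (a ⊔ˡ ℓ)
  Pure = IsPure _≈_ _⊓_ _⊔_
  Trivial : Set ℓ
  Trivial = IsTrivial _≈_ _⊓_ _⊔_ ⊥ ⊤

record IsGluedSum {a ℓ p q r : Level} {D : Set a} (_≈_ : Rel D ℓ)
                  (_≤_ : Rel D r) (P : D → Set p) (Q : D → Set q)
                  : Set (a ⊔ˡ ℓ ⊔ˡ p ⊔ˡ q ⊔ˡ r) where
  field
    covers : ∀ x → P x ⊎ Q x
    e : D
    e∈P : P e
    e∈Q : Q e
    e-greatest-in-P : ∀ x → P x → x ≤ e
    e-least-in-Q : ∀ y → Q y → e ≤ y
    P∩Q≈e : ∀ x → P x → Q x → x ≈ e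
    order : ∀ x y → (x ≤ y) ⇔
      ((P x × P y × x ≤ y) ⊎ (Q x × Q y × x ≤ y) ⊎ (P x × Q y))

-- The construction of part (2): the carrier P •+ Q is represented as the
-- disjoint union P ⊎ Q under the setoid equality identifying 1_P with 0_Q.

module Glue {c₁ ℓ₁ c₂ ℓ₂ : Level}
            (P : BooleanAlgebra c₁ ℓ₁) (Q : BooleanAlgebra c₂ ℓ₂) where
  private
    module P = BooleanAlgebra P
    module Q = BooleanAlgebra Q

  Carrier : Set (c₁ ⊔ˡ c₂)
  Carrier = P.Carrier ⊎ Q.Carrier

  _≈_ : Rel Carrier (ℓ₁ ⊔ˡ ℓ₂)
  inj₁ x ≈ inj₁ y = Lift ℓ₂ (x P.≈ y)
  inj₂ x ≈ inj₂ y = Lift ℓ₁ (x Q.≈ y)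
  inj₁ x ≈ inj₂ y = (x P.≈ P.⊤) × (y Q.≈ Q.⊥)
  inj₂ x ≈ inj₁ y = (x Q.≈ Q.⊥) × (y P.≈ P.⊤)

  ⊥ : Carrier
  ⊥ = inj₁ P.⊥
  ⊤ : Carrier
  ⊤ = inj₂ Q.⊤

  _⊓_ : Op₂ Carrier
  inj₁ x ⊓ inj₁ y = inj₁ (x P.∧ y)
  inj₂ x ⊓ inj₂ y = inj₁ P.⊤
  inj₁ x ⊓ inj₂ y = inj₁ x
  inj₂ x ⊓ inj₁ y = inj₁ y

  _⊔_ : Op₂ Carrier
  inj₂ x ⊔ inj₂ y = inj₂ (x Q.∨ y)
  inj₁ x ⊔ inj₁ y = inj₂ Q.⊥
  inj₁ x ⊔ inj₂ y = inj₂ y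
  inj₂ x ⊔ inj₁ y = inj₂ x

  ¬_ : Op₁ Carrier
  ¬ inj₁ x = inj₁ (P.¬ x)
  ¬ inj₂ x = inj₁ P.⊥

  ⌐_ : Op₁ Carrier
  ⌐ inj₂ x = inj₂ (Q.¬ x)
  ⌐ inj₁ x = inj₂ Q.⊤

{-# OPTIONS --safe #-}
module Submission where

-- (1) In a trivial dBa the element e = ⊤ ⊓ ⊤ = ⊥ ⊔ ⊥ satisfies x ⊓ e = x ⊓ x and
-- x ⊔ e = x ⊔ x, which forces D⊓ ∩ D⊔ = {e}.  For x ∈ D⊓, axiom (12) puts x ⊔ x into
-- D⊓ ∩ D⊔, so x ⊔ x = e, and dually x ⊓ x = e for x ∈ D⊔.  Hence every element of
-- D⊓ lies below every element of D⊔, while an element of D⊔ below an element of D⊓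
-- must be e; with purity this is exactly the glued-sum order.
-- (2) Every ⊓-axiom compares elements of the form inj₁ p, and sending Q to 1_P
-- turns ⊓ and ¬ into ∧ and complement of P, so each becomes a Boolean identity in P.
-- The ⊔-axioms are the same argument for the dual Boolean algebra of Q.

open import Defs
open import Level using (Level; lift) renaming (_⊔_ to _⊔ˡ_)
open import Data.Product using (_×_; _,_)
open import Data.Sum using (_⊎_; inj₁; inj₂)
open import Algebra.Lattice.Bundles using (BooleanAlgebra)
open import Algebra.Core using (Op₁; Op₂)
open import Relation.Binary.Core using (Rel)
open import Relation.Binary.Structures using (IsEquivalence)
open import Relation.Binary.PropositionalEquality as ≡ using (_≡_)
open import Function.Bundles using (mk⇔)
import Algebra.Lattice.Properties.BooleanAlgebra as BooleanAlgebraProperties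
import Relation.Binary.Reasoning.Setoid as SetoidReasoning
open import Relation.Binary.Bundles using (Setoid)

module DBAProperties {a ℓ : Level} (D : DBA a ℓ) where
  open DBA D
  open IsDBA isDBA
  open IsEquivalence isEquivalence

  setoid : Setoid a ℓ
  setoid = record { isEquivalence = isEquivalence }

  open SetoidReasoning setoid

  ⊓-square∈D⊓ : ∀ x → D⊓ (x ⊓ x)
  ⊓-square∈D⊓ x = trans (ax1a x (x ⊓ x)) (trans (ax3a x x x) (ax1a x x))

  ⊔-square∈D⊔ : ∀ x → D⊔ (x ⊔ x)
  ⊔-square∈D⊔ x = trans (ax1b x (x ⊔ x)) (trans (ax3b x x x) (ax1b x x))

  x⊓y⊓y≈x⊓y : ∀ x y → (x ⊓ (y ⊓ y)) ≈ (x ⊓ y)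
  x⊓y⊓y≈x⊓y x y = trans (ax2a x (y ⊓ y)) (trans (ax1a y x) (ax2a y x))

  x⊔y⊔y≈x⊔y : ∀ x y → (x ⊔ (y ⊔ y)) ≈ (x ⊔ y)
  x⊔y⊔y≈x⊔y x y = trans (ax2b x (y ⊔ y)) (trans (ax1b y x) (ax2b y x))

  x⊓⊤≈x⊓x : ∀ x → (x ⊓ ⊤) ≈ (x ⊓ x)
  x⊓⊤≈x⊓x x = trans (⊓-cong refl (sym (ax9b x))) (ax4a x (⌐ x))

  x⊔⊥≈x⊔x : ∀ x → (x ⊔ ⊥) ≈ (x ⊔ x)
  x⊔⊥≈x⊔x x = trans (⊔-cong refl (sym (ax9a x))) (ax4b x (¬ x))

  module WhenTrivial (trivial : Trivial) where

    e : Carrier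
    e = ⊤ ⊓ ⊤

    x⊓e≈x⊓x : ∀ x → (x ⊓ e) ≈ (x ⊓ x)
    x⊓e≈x⊓x x = trans (x⊓y⊓y≈x⊓y x ⊤) (x⊓⊤≈x⊓x x)

    x⊔e≈x⊔x : ∀ x → (x ⊔ e) ≈ (x ⊔ x)
    x⊔e≈x⊔x x = trans (⊔-cong refl trivial) (trans (x⊔y⊔y≈x⊔y x ⊥) (x⊔⊥≈x⊔x x))

    e∈D⊓ : D⊓ e
    e∈D⊓ = ⊓-square∈D⊓ ⊤

    e∈D⊔ : D⊔ e
    e∈D⊔ = begin
      e ⊔ e             ≈⟨ ⊔-cong trivial trivial ⟩
      (⊥ ⊔ ⊥) ⊔ (⊥ ⊔ ⊥) ≈⟨ ⊔-square∈D⊔ ⊥ ⟩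
      ⊥ ⊔ ⊥             ≈⟨ trivial ⟨
      e                 ∎

    D⊓∩D⊔≈e : ∀ z → D⊓ z → D⊔ z → z ≈ e
    D⊓∩D⊔≈e z z∈D⊓ z∈D⊔ = begin
      z           ≈⟨ z∈D⊓ ⟨
      z ⊓ z       ≈⟨ x⊓e≈x⊓x z ⟨
      z ⊓ e       ≈⟨ ax2a z e ⟩
      e ⊓ z       ≈⟨ ⊓-cong refl e⊔z≈z ⟨
      e ⊓ (e ⊔ z) ≈⟨ ax4a e z ⟩
      e ⊓ e       ≈⟨ e∈D⊓ ⟩
      e           ∎
      where
      e⊔z≈z : (e ⊔ z) ≈ z
      e⊔z≈z = trans (ax2b e z) (trans (x⊔e≈x⊔x z) z∈D⊔)

    ∈D⊓⇒x⊔x≈e : ∀ x → D⊓ x → (x ⊔ x) ≈ e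
    ∈D⊓⇒x⊔x≈e x x∈D⊓ =
      D⊓∩D⊔≈e (x ⊔ x) (trans (sym (ax12 x)) (⊔-cong x∈D⊓ x∈D⊓)) (⊔-square∈D⊔ x)

    ∈D⊔⇒x⊓x≈e : ∀ x → D⊔ x → (x ⊓ x) ≈ e
    ∈D⊔⇒x⊓x≈e x x∈D⊔ =
      D⊓∩D⊔≈e (x ⊓ x) (⊓-square∈D⊓ x) (trans (ax12 x) (⊓-cong x∈D⊔ x∈D⊔))

    D⊓⊑D⊔ : ∀ {x y} → D⊓ x → D⊔ y → x ⊑ y
    D⊓⊑D⊔ {x} {y} x∈D⊓ y∈D⊔ = x⊓y≈x⊓x , x⊔y≈y⊔y
      where
      x⊓y≈x⊓x : (x ⊓ y) ≈ (x ⊓ x)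
      x⊓y≈x⊓x = begin
        x ⊓ y       ≈⟨ x⊓y⊓y≈x⊓y x y ⟨
        x ⊓ (y ⊓ y) ≈⟨ ⊓-cong refl (∈D⊔⇒x⊓x≈e y y∈D⊔) ⟩
        x ⊓ e       ≈⟨ x⊓e≈x⊓x x ⟩
        x ⊓ x       ∎
      x⊔y≈y⊔y : (x ⊔ y) ≈ (y ⊔ y)
      x⊔y≈y⊔y = begin
        x ⊔ y       ≈⟨ ax2b x y ⟩
        y ⊔ x       ≈⟨ x⊔y⊔y≈x⊔y y x ⟨
        y ⊔ (x ⊔ x) ≈⟨ ⊔-cong refl (∈D⊓⇒x⊔x≈e x x∈D⊓) ⟩
        y ⊔ e       ≈⟨ x⊔e≈x⊔x y ⟩
        y ⊔ y       ∎

    D⊔⊑D⊓⇒≈e : ∀ {x y} → D⊔ x → D⊓ y → x ⊑ y → x ≈ e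
    D⊔⊑D⊓⇒≈e {x} {y} x∈D⊔ y∈D⊓ (_ , x⊔y≈y⊔y) = begin
      x           ≈⟨ x∈D⊔ ⟨
      x ⊔ x       ≈⟨ x⊔e≈x⊔x x ⟨
      x ⊔ e       ≈⟨ ⊔-cong refl (∈D⊓⇒x⊔x≈e y y∈D⊓) ⟨
      x ⊔ (y ⊔ y) ≈⟨ x⊔y⊔y≈x⊔y x y ⟩
      x ⊔ y       ≈⟨ x⊔y≈y⊔y ⟩
      y ⊔ y       ≈⟨ ∈D⊓⇒x⊔x≈e y y∈D⊓ ⟩
      e           ∎

    ⊑⇒gluedSumOrder : Pure → ∀ x y → x ⊑ y →
      (D⊓ x × D⊓ y × x ⊑ y) ⊎ (D⊔ x × D⊔ y × x ⊑ y) ⊎ (D⊓ x × D⊔ y)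
    ⊑⇒gluedSumOrder pure x y x⊑y with pure x | pure y
    ... | inj₁ x∈D⊓ | inj₁ y∈D⊓ = inj₁ (x∈D⊓ , y∈D⊓ , x⊑y)
    ... | inj₂ x∈D⊔ | inj₂ y∈D⊔ = inj₂ (inj₁ (x∈D⊔ , y∈D⊔ , x⊑y))
    ... | inj₁ x∈D⊓ | inj₂ y∈D⊔ = inj₂ (inj₂ (x∈D⊓ , y∈D⊔))
    ... | inj₂ x∈D⊔ | inj₁ y∈D⊓ = inj₁ (x∈D⊓ , y∈D⊓ , x⊑y)
      where
      x∈D⊓ : D⊓ x
      x∈D⊓ = trans (∈D⊔⇒x⊓x≈e x x∈D⊔) (sym (D⊔⊑D⊓⇒≈e x∈D⊔ y∈D⊓ x⊑y))

    gluedSumOrder⇒⊑ : ∀ x y →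
      (D⊓ x × D⊓ y × x ⊑ y) ⊎ (D⊔ x × D⊔ y × x ⊑ y) ⊎ (D⊓ x × D⊔ y) → x ⊑ y
    gluedSumOrder⇒⊑ x y (inj₁ (_ , _ , x⊑y))         = x⊑y
    gluedSumOrder⇒⊑ x y (inj₂ (inj₁ (_ , _ , x⊑y)))  = x⊑y
    gluedSumOrder⇒⊑ x y (inj₂ (inj₂ (x∈D⊓ , y∈D⊔))) = D⊓⊑D⊔ x∈D⊓ y∈D⊔

    isGluedSum : Pure → IsGluedSum _≈_ _⊑_ D⊓ D⊔
    isGluedSum pure = record
      { covers          = pure
      ; e               = e
      ; e∈P             = e∈D⊓
      ; e∈Q             = e∈D⊔
      ; e-greatest-in-P = λ x x∈D⊓ → D⊓⊑D⊔ x∈D⊓ e∈D⊔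
      ; e-least-in-Q    = λ y y∈D⊔ → D⊓⊑D⊔ e∈D⊓ y∈D⊔
      ; P∩Q≈e           = D⊓∩D⊔≈e
      ; order           = λ x y → mk⇔ (⊑⇒gluedSumOrder pure x y) (gluedSumOrder⇒⊑ x y)
      }

module MeetHalf {b ℓb : Level} (B : BooleanAlgebra b ℓb) where
  open BooleanAlgebra B
    using ( Carrier; _≈_; _∧_; _∨_; refl; sym; trans; ∧-cong; ∨-cong; ∧-comm; ∧-assoc
          ; ∧-absorbs-∨; ∧-distribˡ-∨; ∧-complementʳ )
    renaming (¬_ to ∁_; ¬-cong to ∁-cong; ⊥ to ⊥ᴮ; ⊤ to ⊤ᴮ)
  open BooleanAlgebraProperties B
    using (∧-idem; ∧-identityʳ; deMorgan₁; ¬-involutive; ¬⊥≈⊤; ¬⊤≈⊥)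

  -- π need only be injective on Rep, which contains every value of ⊓ and ¬, so both
  -- sides of each ⊓-axiom are compared through their images in B.
  module Axioms
    {c ℓc r : Level} {C : Set c} (_≋_ : Rel C ℓc) (_⊓_ _⊔_ : Op₂ C) (¬_ : Op₁ C) (⊥ ⊤ : C)
    (π : C → Carrier) (Rep : C → Set r)
    (⊓-rep : ∀ x y → Rep (x ⊓ y)) (¬-rep : ∀ x → Rep (¬ x)) (⊥-rep : Rep ⊥)
    (π-injective : ∀ {u v} → Rep u → Rep v → π u ≈ π v → u ≋ v)
    (π-cong : ∀ {x y} → x ≋ y → π x ≈ π y)
    (π-⊓ : ∀ x y → π (x ⊓ y) ≈ (π x ∧ π y))
    (π-¬ : ∀ x → π (¬ x) ≈ (∁ π x))
    (π-⊔ : ∀ x y → π (x ⊔ y) ≈ ⊤ᴮ)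
    (π-⊥ : π ⊥ ≈ ⊥ᴮ)
    (π-⊤ : π ⊤ ≈ ⊤ᴮ)
    where

    infixr 5 _∙_
    _∙_ : ∀ {x y z} → x ≈ y → y ≈ z → x ≈ z
    _∙_ = trans

    ≋-from-images : ∀ {u v t} → Rep u → Rep v → π u ≈ t → π v ≈ t → u ≋ v
    ≋-from-images u-rep v-rep πu≈t πv≈t = π-injective u-rep v-rep (πu≈t ∙ sym πv≈t)

    _∨′_ : Op₂ C
    x ∨′ y = ¬ ((¬ x) ⊓ (¬ y))

    π-∨ : ∀ x y → π (x ∨′ y) ≈ (π x ∨ π y)
    π-∨ x y = π-¬ _ ∙ ∁-cong (π-⊓ _ _ ∙ ∧-cong (π-¬ x) (π-¬ y))
            ∙ deMorgan₁ _ _ ∙ ∨-cong (¬-involutive _) (¬-involutive _)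

    ⊓-cong : ∀ {x x′ y y′} → x ≋ x′ → y ≋ y′ → (x ⊓ y) ≋ (x′ ⊓ y′)
    ⊓-cong p q = ≋-from-images (⊓-rep _ _) (⊓-rep _ _) (π-⊓ _ _ ∙ ∧-cong (π-cong p) (π-cong q)) (π-⊓ _ _)

    ¬-cong : ∀ {x x′} → x ≋ x′ → (¬ x) ≋ (¬ x′)
    ¬-cong p = ≋-from-images (¬-rep _) (¬-rep _) (π-¬ _ ∙ ∁-cong (π-cong p)) (π-¬ _)

    ax1 : ∀ x y → ((x ⊓ x) ⊓ y) ≋ (x ⊓ y)
    ax1 x y = ≋-from-images (⊓-rep _ _) (⊓-rep _ _)
      (π-⊓ _ _ ∙ ∧-cong (π-⊓ x x ∙ ∧-idem _) refl) (π-⊓ x y)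

    ax2 : ∀ x y → (x ⊓ y) ≋ (y ⊓ x)
    ax2 x y = ≋-from-images (⊓-rep _ _) (⊓-rep _ _) (π-⊓ x y ∙ ∧-comm _ _) (π-⊓ y x)

    ax3 : ∀ x y z → (x ⊓ (y ⊓ z)) ≋ ((x ⊓ y) ⊓ z)
    ax3 x y z = ≋-from-images (⊓-rep _ _) (⊓-rep _ _)
      (π-⊓ _ _ ∙ ∧-cong refl (π-⊓ y z) ∙ sym (∧-assoc _ _ _)) (π-⊓ _ _ ∙ ∧-cong (π-⊓ x y) refl)

    ax4 : ∀ x y → (x ⊓ (x ⊔ y)) ≋ (x ⊓ x)
    ax4 x y = ≋-from-images (⊓-rep _ _) (⊓-rep _ _)
      (π-⊓ _ _ ∙ ∧-cong refl (π-⊔ x y) ∙ ∧-identityʳ _ ∙ sym (∧-idem _)) (π-⊓ x x)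

    ax5 : ∀ x y → (x ⊓ (x ∨′ y)) ≋ (x ⊓ x)
    ax5 x y = ≋-from-images (⊓-rep _ _) (⊓-rep _ _)
      (π-⊓ _ _ ∙ ∧-cong refl (π-∨ x y) ∙ ∧-absorbs-∨ _ _ ∙ sym (∧-idem _)) (π-⊓ x x)

    ax6 : ∀ x y z → (x ⊓ (y ∨′ z)) ≋ ((x ⊓ y) ∨′ (x ⊓ z))
    ax6 x y z = ≋-from-images (⊓-rep _ _) (¬-rep _)
      (π-⊓ _ _ ∙ ∧-cong refl (π-∨ y z) ∙ ∧-distribˡ-∨ _ _ _)
      (π-∨ _ _ ∙ ∨-cong (π-⊓ x y) (π-⊓ x z))

    ax7 : ∀ x y → (¬ (¬ (x ⊓ y))) ≋ (x ⊓ y)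
    ax7 x y = ≋-from-images (¬-rep _) (⊓-rep _ _) (π-¬ _ ∙ ∁-cong (π-¬ _) ∙ ¬-involutive _) refl

    ax8 : ∀ x → (¬ (x ⊓ x)) ≋ (¬ x)
    ax8 x = ≋-from-images (¬-rep _) (¬-rep _) (π-¬ _ ∙ ∁-cong (π-⊓ x x ∙ ∧-idem _)) (π-¬ x)

    ax9 : ∀ x → (x ⊓ (¬ x)) ≋ ⊥
    ax9 x = ≋-from-images (⊓-rep _ _) ⊥-rep (π-⊓ _ _ ∙ ∧-cong refl (π-¬ x) ∙ ∧-complementʳ _) π-⊥

    ax10 : (¬ ⊥) ≋ (⊤ ⊓ ⊤)
    ax10 = ≋-from-images (¬-rep _) (⊓-rep _ _)
      (π-¬ _ ∙ ∁-cong π-⊥ ∙ ¬⊥≈⊤) (π-⊓ _ _ ∙ ∧-cong π-⊤ π-⊤ ∙ ∧-idem _)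

    ax11 : (¬ ⊤) ≋ ⊥
    ax11 = ≋-from-images (¬-rep _) ⊥-rep (π-¬ _ ∙ ∁-cong π-⊤ ∙ ¬⊤≈⊥) π-⊥

module GlueProperties {c₁ ℓ₁ c₂ ℓ₂ : Level} (P : BooleanAlgebra c₁ ℓ₁) (Q : BooleanAlgebra c₂ ℓ₂) where
  open Glue P Q
  private
    module P = BooleanAlgebra P
    module Q = BooleanAlgebra Q
    module PP = BooleanAlgebraProperties P
    module QP = BooleanAlgebraProperties Q

  toP : Carrier → P.Carrier
  toP (inj₁ x) = x
  toP (inj₂ _) = P.⊤

  toQ : Carrier → Q.Carrier
  toQ (inj₁ _) = Q.⊥
  toQ (inj₂ y) = y

  InP : Carrier → Set (c₁ ⊔ˡ c₂)
  InP u = u ≡ inj₁ (toP u)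

  InQ : Carrier → Set (c₁ ⊔ˡ c₂)
  InQ u = u ≡ inj₂ (toQ u)

  ⊓-InP : ∀ x y → InP (x ⊓ y)
  ⊓-InP (inj₁ _) (inj₁ _) = ≡.refl
  ⊓-InP (inj₁ _) (inj₂ _) = ≡.refl
  ⊓-InP (inj₂ _) (inj₁ _) = ≡.refl
  ⊓-InP (inj₂ _) (inj₂ _) = ≡.refl

  ¬-InP : ∀ x → InP (¬ x)
  ¬-InP (inj₁ _) = ≡.refl
  ¬-InP (inj₂ _) = ≡.refl

  ⊔-InQ : ∀ x y → InQ (x ⊔ y)
  ⊔-InQ (inj₁ _) (inj₁ _) = ≡.refl
  ⊔-InQ (inj₁ _) (inj₂ _) = ≡.refl
  ⊔-InQ (inj₂ _) (inj₁ _) = ≡.refl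
  ⊔-InQ (inj₂ _) (inj₂ _) = ≡.refl

  ⌐-InQ : ∀ x → InQ (⌐ x)
  ⌐-InQ (inj₁ _) = ≡.refl
  ⌐-InQ (inj₂ _) = ≡.refl

  toP-injective : ∀ {u v} → InP u → InP v → toP u P.≈ toP v → u ≈ v
  toP-injective {inj₁ _} {inj₁ _} _ _ p = lift p

  toQ-injective : ∀ {u v} → InQ u → InQ v → toQ u Q.≈ toQ v → u ≈ v
  toQ-injective {inj₂ _} {inj₂ _} _ _ p = lift p

  toP-cong : ∀ {x y} → x ≈ y → toP x P.≈ toP y
  toP-cong {inj₁ _} {inj₁ _} (lift p) = p
  toP-cong {inj₁ _} {inj₂ _} (p , _)  = p
  toP-cong {inj₂ _} {inj₁ _} (_ , p)  = P.sym p
  toP-cong {inj₂ _} {inj₂ _} _        = P.refl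

  toQ-cong : ∀ {x y} → x ≈ y → toQ x Q.≈ toQ y
  toQ-cong {inj₁ _} {inj₁ _} _        = Q.refl
  toQ-cong {inj₁ _} {inj₂ _} (_ , p)  = Q.sym p
  toQ-cong {inj₂ _} {inj₁ _} (p , _)  = p
  toQ-cong {inj₂ _} {inj₂ _} (lift p) = p

  toP-⊓ : ∀ x y → toP (x ⊓ y) P.≈ (toP x P.∧ toP y)
  toP-⊓ (inj₁ _) (inj₁ _) = P.refl
  toP-⊓ (inj₁ _) (inj₂ _) = P.sym (PP.∧-identityʳ _)
  toP-⊓ (inj₂ _) (inj₁ _) = P.sym (PP.∧-identityˡ _)
  toP-⊓ (inj₂ _) (inj₂ _) = P.sym (PP.∧-idem _)

  toP-¬ : ∀ x → toP (¬ x) P.≈ (P.¬ toP x)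
  toP-¬ (inj₁ _) = P.refl
  toP-¬ (inj₂ _) = P.sym PP.¬⊤≈⊥

  toP-⊔ : ∀ x y → toP (x ⊔ y) P.≈ P.⊤
  toP-⊔ x y rewrite ⊔-InQ x y = P.refl

  toQ-⊔ : ∀ x y → toQ (x ⊔ y) Q.≈ (toQ x Q.∨ toQ y)
  toQ-⊔ (inj₂ _) (inj₂ _) = Q.refl
  toQ-⊔ (inj₂ _) (inj₁ _) = Q.sym (QP.∨-identityʳ _)
  toQ-⊔ (inj₁ _) (inj₂ _) = Q.sym (QP.∨-identityˡ _)
  toQ-⊔ (inj₁ _) (inj₁ _) = Q.sym (QP.∨-idem _)

  toQ-⌐ : ∀ x → toQ (⌐ x) Q.≈ (Q.¬ toQ x)
  toQ-⌐ (inj₂ _) = Q.refl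
  toQ-⌐ (inj₁ _) = Q.sym QP.¬⊥≈⊤

  toQ-⊓ : ∀ x y → toQ (x ⊓ y) Q.≈ Q.⊥
  toQ-⊓ x y rewrite ⊓-InP x y = Q.refl

  module ⊓-Half = MeetHalf.Axioms P _≈_ _⊓_ _⊔_ ¬_ ⊥ ⊤ toP InP ⊓-InP ¬-InP ≡.refl
    toP-injective toP-cong toP-⊓ toP-¬ toP-⊔ P.refl P.refl
  -- ∧-∨-booleanAlgebra is Q with ∧/∨ and ⊥/⊤ exchanged.
  module ⊔-Half = MeetHalf.Axioms QP.∧-∨-booleanAlgebra _≈_ _⊔_ _⊓_ ⌐_ ⊤ ⊥ toQ InQ ⊔-InQ ⌐-InQ ≡.refl
    toQ-injective toQ-cong toQ-⊔ toQ-⌐ toQ-⊓ Q.refl Q.refl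

  ≈-isEquivalence : IsEquivalence _≈_
  ≈-isEquivalence = record { refl = ≈-refl ; sym = ≈-sym ; trans = ≈-trans }
    where
    ≈-refl : ∀ {x} → x ≈ x
    ≈-refl {inj₁ _} = lift P.refl
    ≈-refl {inj₂ _} = lift Q.refl
    ≈-sym : ∀ {x y} → x ≈ y → y ≈ x
    ≈-sym {inj₁ _} {inj₁ _} (lift p) = lift (P.sym p)
    ≈-sym {inj₂ _} {inj₂ _} (lift p) = lift (Q.sym p)
    ≈-sym {inj₁ _} {inj₂ _} (p , q)  = q , p
    ≈-sym {inj₂ _} {inj₁ _} (p , q)  = q , p
    ≈-trans : ∀ {x y z} → x ≈ y → y ≈ z → x ≈ z
    ≈-trans {inj₁ _} {inj₁ _} {inj₁ _} (lift p) (lift q) = lift (P.trans p q)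
    ≈-trans {inj₁ _} {inj₁ _} {inj₂ _} (lift p) (q , q′) = P.trans p q , q′
    ≈-trans {inj₁ _} {inj₂ _} {inj₁ _} (p , _) (_ , q)   = lift (P.trans p (P.sym q))
    ≈-trans {inj₁ _} {inj₂ _} {inj₂ _} (p , p′) (lift q) = p , Q.trans (Q.sym q) p′
    ≈-trans {inj₂ _} {inj₁ _} {inj₁ _} (p , p′) (lift q) = p , P.trans (P.sym q) p′
    ≈-trans {inj₂ _} {inj₁ _} {inj₂ _} (p , _) (_ , q)   = lift (Q.trans p (Q.sym q))
    ≈-trans {inj₂ _} {inj₂ _} {inj₁ _} (lift p) (q , q′) = Q.trans p q , q′
    ≈-trans {inj₂ _} {inj₂ _} {inj₂ _} (lift p) (lift q) = lift (Q.trans p q)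

  ax12 : ∀ x → ((x ⊓ x) ⊔ (x ⊓ x)) ≈ ((x ⊔ x) ⊓ (x ⊔ x))
  ax12 (inj₁ _) = Q.refl , P.refl
  ax12 (inj₂ _) = Q.refl , P.refl

  isDBA : IsDBA _≈_ _⊓_ _⊔_ ¬_ ⌐_ ⊥ ⊤
  isDBA = record
    { isEquivalence = ≈-isEquivalence
    ; ⊓-cong = ⊓-Half.⊓-cong ; ⊔-cong = ⊔-Half.⊓-cong
    ; ¬-cong = ⊓-Half.¬-cong ; ⌐-cong = ⊔-Half.¬-cong
    ; ax1a = ⊓-Half.ax1 ; ax1b = ⊔-Half.ax1 ; ax2a = ⊓-Half.ax2 ; ax2b = ⊔-Half.ax2
    ; ax3a = ⊓-Half.ax3 ; ax3b = ⊔-Half.ax3 ; ax4a = ⊓-Half.ax4 ; ax4b = ⊔-Half.ax4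
    ; ax5a = ⊓-Half.ax5 ; ax5b = ⊔-Half.ax5 ; ax6a = ⊓-Half.ax6 ; ax6b = ⊔-Half.ax6
    ; ax7a = ⊓-Half.ax7 ; ax7b = ⊔-Half.ax7 ; ax8a = ⊓-Half.ax8 ; ax8b = ⊔-Half.ax8
    ; ax9a = ⊓-Half.ax9 ; ax9b = ⊔-Half.ax9 ; ax10a = ⊓-Half.ax10 ; ax10b = ⊔-Half.ax10
    ; ax11a = ⊓-Half.ax11 ; ax11b = ⊔-Half.ax11 ; ax12 = ax12
    }

  pure : IsPure _≈_ _⊓_ _⊔_
  pure (inj₁ x) = inj₁ (lift (PP.∧-idem x))
  pure (inj₂ y) = inj₂ (lift (QP.∨-idem y))

  trivial : IsTrivial _≈_ _⊓_ _⊔_ ⊥ ⊤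
  trivial = P.refl , Q.refl

theorem3p5 : ∀ {a ℓ c₁ ℓ₁ c₂ ℓ₂ : Level}
    → ((D : DBA a ℓ) → DBA.Pure D → DBA.Trivial D
        → IsGluedSum (DBA._≈_ D) (DBA._⊑_ D) (DBA.D⊓ D) (DBA.D⊔ D))
    × ((P : BooleanAlgebra c₁ ℓ₁) (Q : BooleanAlgebra c₂ ℓ₂)
        → IsDBA (Glue._≈_ P Q) (Glue._⊓_ P Q) (Glue._⊔_ P Q) (Glue.¬_ P Q) (Glue.⌐_ P Q) (Glue.⊥ P Q) (Glue.⊤ P Q)
          × IsPure (Glue._≈_ P Q) (Glue._⊓_ P Q) (Glue._⊔_ P Q)
          × IsTrivial (Glue._≈_ P Q) (Glue._⊓_ P Q) (Glue._⊔_ P Q) (Glue.⊥ P Q) (Glue.⊤ P Q))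
theorem3p5 =
    (λ D pure trivial → DBAProperties.WhenTrivial.isGluedSum D trivial pure)
  , (λ P Q → let open GlueProperties P Q in isDBA , pure , trivial)
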